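{- For every integer $n\ge 2$, there exists a simple series-parallel graph $G$ on $n$ vertices with $b(G)\le \lceil \log_2 n\rceil+1$.
   Context: A multigraph is series-parallel (SP) if it can be obtained from $K_2$ by a finite sequence of series extensions (replace an edge $\{x,y\}$ by a new vertex $z$ and edges $\{x,z\},\{z,y\}$) and parallel extensions (add an edge parallel to an existing edge); a simple graph is SP if it is the result of such a sequence with no multiple edges at the end. Broadcasting: initially only an originator holds a message; in each discrete time unit, every informed vertex may inform at most one uninformed neighbor. $b(v,G)$ is the minimum number of time units to inform all vertices from originator $v$, and $b(G)=\max_v b(v,G)$. -}

module Defs where

open import Data.Nat using (ℕ; zero; suc)
open import Data.Fin using (Fin; zero; suc; inject₁; fromℕ)
open import Data.Fin.Subset using (Subset; _∈_; _∉_; _∪_; ⁅_⁆; ⊥)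
open import Data.List using (List; []; _∷_; map; length; lookup; _++_; foldr)
open import Data.List.Base using (removeAt)
open import Data.List.Membership.Propositional using () renaming (_∈_ to _∈ₗ_)
open import Data.List.Relation.Unary.All using (All)
open import Data.List.Relation.Unary.Unique.Propositional using (Unique)
open import Data.List.Relation.Binary.Permutation.Propositional using (_↭_)
open import Data.Product using (_×_; _,_; proj₁; proj₂; Σ)
open import Data.Sum using (_⊎_)
open import Relation.Binary.PropositionalEquality using (_≡_)
open import Relation.Nullary using (¬_)

-- A multigraph on vertex set Fin n is given by a list (multiset) of edges;
-- an edge (x , y) represents the unordered pair {x , y}.
Edge : ℕ → Set
Edge n = Fin n × Fin n

liftE : ∀ {n} → Edge n → Edge (suc n)
liftE (x , y) = inject₁ x , inject₁ y

-- Edge lists are taken up to reordering and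
-- edges up to orientation (constructors perm and flip).
data SP : (n : ℕ) → List (Edge n) → Set where
  K₂       : SP 2 ((zero , suc zero) ∷ [])
  series   : ∀ {n E} → SP n E → (i : Fin (length E)) →
             SP (suc n) ((inject₁ (proj₁ (lookup E i)) , fromℕ n)
                         ∷ (fromℕ n , inject₁ (proj₂ (lookup E i)))
                         ∷ map liftE (removeAt E i))
  parallel : ∀ {n E e} → SP n E → e ∈ₗ E → SP n (e ∷ E)
  perm     : ∀ {n E E′} → SP n E → E ↭ E′ → SP n E′
  flip     : ∀ {n x y} E₁ E₂ → SP n (E₁ ++ (x , y) ∷ E₂) → SP n (E₁ ++ (y , x) ∷ E₂)

Adj : ∀ {n} → List (Edge n) → Fin n → Fin n → Set
Adj E u w = ((u , w) ∈ₗ E) ⊎ ((w , u) ∈ₗ E)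

SameEnds : ∀ {n} → Edge n → Edge n → Set
SameEnds (a , b) (c , d) = ((a ≡ c) × (b ≡ d)) ⊎ ((a ≡ d) × (b ≡ c))

NoParallel : ∀ {n} → List (Edge n) → Set
NoParallel [] = Data.Unit.⊤ where import Data.Unit
NoParallel (e ∷ E) = All (λ f → ¬ SameEnds e f) E × NoParallel E

NoLoop : ∀ {n} → List (Edge n) → Set
NoLoop E = All (λ e → ¬ (proj₁ e ≡ proj₂ e)) E

SimpleSP : (n : ℕ) → List (Edge n) → Set
SimpleSP n E = SP n E × NoLoop E × NoParallel E

receivers : ∀ {n} → List (Edge n) → Subset n
receivers = foldr (λ c S → ⁅ proj₂ c ⁆ ∪ S) ⊥

-- Broadcast E I t : starting with informed set I, all vertices can be
-- informed within t time units.
data Broadcast {n : ℕ} (E : List (Edge n)) : Subset n → ℕ → Set where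
  done : ∀ {I t} → (∀ v → v ∈ I) → Broadcast E I t
  step : ∀ {I t} (calls : List (Edge n)) →
         All (λ c → (proj₁ c ∈ I) × (proj₂ c ∉ I) × Adj E (proj₁ c) (proj₂ c)) calls →
         Unique (map proj₁ calls) →
         Broadcast E (I ∪ receivers calls) t →
         Broadcast E I (suc t)

BroadcastTimeFrom≤ : ∀ {n} → List (Edge n) → Fin n → ℕ → Set
BroadcastTimeFrom≤ E v t = Broadcast E ⁅ v ⁆ t

BroadcastTime≤ : ∀ {n} → List (Edge n) → ℕ → Set
BroadcastTime≤ E t = ∀ v → BroadcastTimeFrom≤ E v t

-- Take the apex 0 joined to every vertex, and attach each vertex k ≥ 2 also to
-- p(k) = k − 2^⌊log₂(k−1)⌋, so that p(j + 2^r) = j whenever 0 < j < 2^r.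
-- Adding the vertices in order is a series extension of a parallel copy of the
-- apex edge {0, p(k)}, so the graph is simple series-parallel.  From 0, in
-- round r every j < 2^r calls j + 2^r, which informs 2^t vertices in t rounds;
-- any other originator first calls the apex, costing one extra round.
module Submission where

open import Defs
open import Data.Nat
  using (ℕ; zero; suc; _+_; _*_; _^_; _∸_; _≤_; _<_; z≤n; s≤s; z<s; _<?_; NonZero; >-nonZero; ⌊_/2⌋; ⌈_/2⌉)
open import Data.Nat.Properties hiding (_≟_)
open import Data.Nat.Logarithm using (⌊log₂_⌋; ⌈log₂_⌉; ⌊log₂⌋-mono-≤; ⌊log₂[2^n]⌋≡n)
open import Data.Nat.Logarithm.Core using (⌊log2⌋; ⌈log2⌉)
open import Data.Fin using (Fin; zero; suc; toℕ; fromℕ; fromℕ<; inject₁; _≟_)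
open import Data.Fin.Properties using (toℕ-injective; toℕ-fromℕ<; toℕ-fromℕ; toℕ-inject₁; toℕ<n; inject₁-injective; fromℕ≢inject₁; inject₁ℕ<)
open import Data.Fin.Subset using (Subset; ⁅_⁆; _∪_) renaming (_∈_ to _∈ₛ_; _∉_ to _∉ₛ_)
open import Data.Fin.Subset.Properties using (_∈?_; x∈⁅x⁆; x∈⁅y⁆⇒x≡y; x∈p∪q⁺)
open import Data.List using (List; []; _∷_; map; filter; allFin)
open import Data.List.Properties using (map-∘; map-id)
open import Data.List.Membership.Propositional using () renaming (_∈_ to _∈ₗ_)
open import Data.List.Membership.Propositional.Properties using (∈-map⁺; ∈-filter⁺; ∈-filter⁻; ∈-allFin)
open import Data.List.Relation.Unary.Any using (here; there)
open import Data.List.Relation.Unary.All as All using (All; []; _∷_)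
import Data.List.Relation.Unary.All.Properties as AllP
import Data.List.Relation.Unary.AllPairs as AllPairs
open import Data.List.Relation.Unary.Unique.Propositional using (Unique)
open import Data.List.Relation.Unary.Unique.Propositional.Properties using (allFin⁺; filter⁺)
open import Data.Product using (Σ; _×_; _,_; proj₁; proj₂)
open import Data.Sum using (inj₁; inj₂)
open import Data.Empty using (⊥-elim)
open import Data.Unit using (tt)
open import Induction.WellFounded using (Acc; acc)
open import Relation.Nullary using (¬_; Dec; yes; no)
open import Relation.Nullary.Decidable using (_×-dec_; ¬?)
open import Function using (_∘_)
open import Relation.Binary.PropositionalEquality using (_≡_; _≢_; refl; sym; trans; cong; subst; module ≡-Reasoning)

2*⌊n/2⌋≤n : ∀ n → 2 * ⌊ n /2⌋ ≤ n
2*⌊n/2⌋≤n zero          = z≤n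
2*⌊n/2⌋≤n (suc zero)    = z≤n
2*⌊n/2⌋≤n (suc (suc n)) rewrite *-suc 2 ⌊ n /2⌋ = s≤s (s≤s (2*⌊n/2⌋≤n n))

n≤2*⌈n/2⌉ : ∀ n → n ≤ 2 * ⌈ n /2⌉
n≤2*⌈n/2⌉ zero          = z≤n
n≤2*⌈n/2⌉ (suc zero)    = s≤s z≤n
n≤2*⌈n/2⌉ (suc (suc n)) rewrite *-suc 2 ⌈ n /2⌉ = s≤s (s≤s (n≤2*⌈n/2⌉ n))

2^⌊log₂n⌋≤n : ∀ n .{{_ : NonZero n}} → 2 ^ ⌊log₂ n ⌋ ≤ n
2^⌊log₂n⌋≤n (suc n) = go n _
  where
  go : ∀ n (a : Acc _<_ (suc n)) → 2 ^ ⌊log2⌋ (suc n) a ≤ suc n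
  go zero    _        = ≤-refl
  go (suc n) (acc rs) = ≤-trans (*-monoʳ-≤ 2 (go ⌊ n /2⌋ _)) (2*⌊n/2⌋≤n (suc (suc n)))

n≤2^⌈log₂n⌉ : ∀ n → n ≤ 2 ^ ⌈log₂ n ⌉
n≤2^⌈log₂n⌉ n = go n _
  where
  go : ∀ n (a : Acc _<_ n) → n ≤ 2 ^ ⌈log2⌉ n a
  go zero          _        = z≤n
  go (suc zero)    _        = ≤-refl
  go (suc (suc n)) (acc rs) = ≤-trans (n≤2*⌈n/2⌉ (suc (suc n))) (*-monoʳ-≤ 2 (go (suc ⌈ n /2⌉) _))

2^[1+n]≡2^n+2^n : ∀ n → 2 ^ suc n ≡ 2 ^ n + 2 ^ n
2^[1+n]≡2^n+2^n n = cong (2 ^ n +_) (+-identityʳ (2 ^ n))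

⌊log₂[m+2^n]⌋≡n : ∀ m n → m < 2 ^ n → ⌊log₂ (m + 2 ^ n) ⌋ ≡ n
⌊log₂[m+2^n]⌋≡n m n m<2^n = ≤-antisym upper lower
  where
  k = m + 2 ^ n
  instance _ = >-nonZero (≤-trans (m^n>0 2 n) (m≤n+m (2 ^ n) m))
  k<2^[1+n] : k < 2 ^ suc n
  k<2^[1+n] = subst (k <_) (sym (2^[1+n]≡2^n+2^n n)) (+-monoˡ-< (2 ^ n) m<2^n)
  upper : ⌊log₂ k ⌋ ≤ n
  upper = ≮⇒≥ λ n<log → <⇒≱ k<2^[1+n] (≤-trans (^-monoʳ-≤ 2 n<log) (2^⌊log₂n⌋≤n k))
  lower : n ≤ ⌊log₂ k ⌋
  lower = subst (_≤ ⌊log₂ k ⌋) (⌊log₂[2^n]⌋≡n n) (⌊log₂⌋-mono-≤ (m≤n+m (2 ^ n) m))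

parent : ℕ → ℕ
parent zero    = zero
parent (suc i) = suc i ∸ 2 ^ ⌊log₂ i ⌋

parent>0 : ∀ {n} → 2 ≤ n → 0 < parent n
parent>0 (s≤s {n = suc i} (s≤s _)) = m<n⇒0<n∸m (s≤s (2^⌊log₂n⌋≤n (suc i)))

parent[n]<n : ∀ {n} → 2 ≤ n → parent n < n
parent[n]<n (s≤s {n = suc i} (s≤s _)) = ∸-monoʳ-< (m^n>0 2 ⌊log₂ suc i ⌋) (m≤n⇒m≤1+n (2^⌊log₂n⌋≤n (suc i)))

parent[m+2^n]≡m : ∀ {m} n → 0 < m → m < 2 ^ n → parent (m + 2 ^ n) ≡ m
parent[m+2^n]≡m {suc j} n _ m<2^n
  rewrite ⌊log₂[m+2^n]⌋≡n j n (<-trans (n<1+n j) m<2^n) = m+n∸n≡m (suc j) (2 ^ n)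

data LastView {n : ℕ} : Fin (suc n) → Set where
  last : LastView (fromℕ n)
  inj  : (k : Fin n) → LastView (inject₁ k)

lastView : ∀ {n} (k : Fin (suc n)) → LastView k
lastView {zero}  zero    = last
lastView {suc n} zero    = inj zero
lastView {suc n} (suc k) with lastView k
... | last  = last
... | inj k = inj (suc k)

parentFin : ∀ m → Fin (2 + m)
parentFin m = fromℕ< (parent[n]<n {2 + m} (s≤s (s≤s z≤n)))

toℕ-parentFin : ∀ m → toℕ (parentFin m) ≡ parent (2 + m)
toℕ-parentFin m = toℕ-fromℕ< _

parentFin≢0 : ∀ m → parentFin m ≢ zero
parentFin≢0 m eq = <⇒≢ (parent>0 {2 + m} (s≤s (s≤s z≤n))) (trans (sym (cong toℕ eq)) (toℕ-parentFin m))

G : ∀ m → List (Edge (2 + m))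
G zero    = (zero , suc zero) ∷ []
G (suc m) = (zero , fromℕ (2 + m)) ∷ (fromℕ (2 + m) , inject₁ (parentFin m)) ∷ map liftE (G m)

apex∈G : ∀ m (k : Fin (2 + m)) → k ≢ zero → (zero , k) ∈ₗ G m
apex∈G zero    zero          k≢0 = ⊥-elim (k≢0 refl)
apex∈G zero    (suc zero)    _   = here refl
apex∈G (suc m) k             k≢0 with lastView k
... | last  = here refl
... | inj k = there (there (∈-map⁺ liftE (apex∈G m k (λ k≡0 → k≢0 (cong inject₁ k≡0)))))

parent∈G : ∀ m (k j : Fin (2 + m)) → 2 ≤ toℕ k → toℕ j ≡ parent (toℕ k) → (k , j) ∈ₗ G m
parent∈G zero    zero       j ()             _
parent∈G zero    (suc zero) j (s≤s ())       _
parent∈G (suc m) k          j 2≤k            j≡pk with lastView k | lastView j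
... | last  | _     = there (here (cong (fromℕ (2 + m) ,_) (toℕ-injective (begin
  toℕ j                        ≡⟨ j≡pk ⟩
  parent (toℕ (fromℕ (2 + m))) ≡⟨ cong parent (toℕ-fromℕ (2 + m)) ⟩
  parent (2 + m)               ≡⟨ sym (toℕ-parentFin m) ⟩
  toℕ (parentFin m)            ≡⟨ sym (toℕ-inject₁ (parentFin m)) ⟩
  toℕ (inject₁ (parentFin m))  ∎))))
  where open ≡-Reasoning
... | inj k | last  = ⊥-elim (<-irrefl refl (begin-strict
  2 + m                    ≡⟨ sym (toℕ-fromℕ (2 + m)) ⟩
  toℕ (fromℕ (2 + m))      ≡⟨ j≡pk ⟩
  parent (toℕ (inject₁ k)) <⟨ parent[n]<n 2≤k ⟩
  toℕ (inject₁ k)          <⟨ inject₁ℕ< k ⟩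
  2 + m                    ∎))
  where open ≤-Reasoning
... | inj k | inj j = there (there (∈-map⁺ liftE (parent∈G m k j
  (subst (2 ≤_) (toℕ-inject₁ k) 2≤k)
  (trans (sym (toℕ-inject₁ j)) (trans j≡pk (cong parent (toℕ-inject₁ k)))))))

G-SP : ∀ m → SP (2 + m) (G m)
G-SP zero    = K₂
G-SP (suc m) = series (parallel (G-SP m) (apex∈G m (parentFin m) (parentFin≢0 m))) zero

NoLoop-liftE : ∀ {n} {E : List (Edge n)} → NoLoop E → NoLoop (map liftE E)
NoLoop-liftE = AllP.map⁺ ∘ All.map (λ x≢y → x≢y ∘ inject₁-injective)

SameEnds-liftE⁻ : ∀ {n} {e f : Edge n} → SameEnds (liftE e) (liftE f) → SameEnds e f
SameEnds-liftE⁻ (inj₁ (a≡c , b≡d)) = inj₁ (inject₁-injective a≡c , inject₁-injective b≡d)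
SameEnds-liftE⁻ (inj₂ (a≡d , b≡c)) = inj₂ (inject₁-injective a≡d , inject₁-injective b≡c)

NoParallel-liftE : ∀ {n} {E : List (Edge n)} → NoParallel E → NoParallel (map liftE E)
NoParallel-liftE {E = []}    _          = tt
NoParallel-liftE {E = _ ∷ _} (e∦E , np) = AllP.map⁺ (All.map (_∘ SameEnds-liftE⁻) e∦E) , NoParallel-liftE np

fresh∦liftE : ∀ {n} x (E : List (Edge n)) → All (λ f → ¬ SameEnds (x , fromℕ n) f) (map liftE E)
fresh∦liftE x E = AllP.map⁺ (All.universal (λ _ → λ
  { (inj₁ (_ , last≡b)) → fromℕ≢inject₁ last≡b
  ; (inj₂ (_ , last≡a)) → fromℕ≢inject₁ last≡a }) E)

fresh∦liftE′ : ∀ {n} x (E : List (Edge n)) → All (λ f → ¬ SameEnds (fromℕ n , x) f) (map liftE E)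
fresh∦liftE′ x E = AllP.map⁺ (All.universal (λ _ → λ
  { (inj₁ (last≡a , _)) → fromℕ≢inject₁ last≡a
  ; (inj₂ (last≡b , _)) → fromℕ≢inject₁ last≡b }) E)

G-NoLoop : ∀ m → NoLoop (G m)
G-NoLoop zero    = (λ ()) ∷ []
G-NoLoop (suc m) = (λ ()) ∷ fromℕ≢inject₁ ∷ NoLoop-liftE (G-NoLoop m)

G-NoParallel : ∀ m → NoParallel (G m)
G-NoParallel zero    = [] , tt
G-NoParallel (suc m) =
  (apex∦parent ∷ fresh∦liftE zero (G m)) ,
  (fresh∦liftE′ (inject₁ (parentFin m)) (G m) , NoParallel-liftE (G-NoParallel m))
  where
  apex∦parent : ¬ SameEnds (zero , fromℕ (2 + m)) (fromℕ (2 + m) , inject₁ (parentFin m))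
  apex∦parent (inj₂ (0≡p , _)) = parentFin≢0 m (inject₁-injective (sym 0≡p))

G-simple : ∀ m → SimpleSP (2 + m) (G m)
G-simple m = G-SP m , G-NoLoop m , G-NoParallel m

G-doubling-adj : ∀ m r (u v : Fin (2 + m)) → toℕ u < 2 ^ r → toℕ v ≡ toℕ u + 2 ^ r → Adj (G m) u v
G-doubling-adj m r zero    v _     v≡2^r = inj₁ (apex∈G m v λ { refl → <⇒≢ (m^n>0 2 r) v≡2^r })
G-doubling-adj m r (suc u) v u<2^r v≡u+2^r = inj₂ (parent∈G m v (suc u) 2≤v
  (sym (trans (cong parent v≡u+2^r) (parent[m+2^n]≡m r z<s u<2^r))))
  where
  2≤v : 2 ≤ toℕ v
  2≤v = subst (2 ≤_) (sym v≡u+2^r) (+-mono-≤ (s≤s (z≤n {toℕ u})) (m^n>0 2 r))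

∈-receivers : ∀ {n} {c} {cs : List (Edge n)} → c ∈ₗ cs → proj₂ c ∈ₛ receivers cs
∈-receivers (here refl) = x∈p∪q⁺ (inj₁ (x∈⁅x⁆ _))
∈-receivers (there c∈)  = x∈p∪q⁺ (inj₂ (∈-receivers c∈))

single-call : ∀ {n} {E : List (Edge n)} {I u w t} → u ∈ₛ I → w ∉ₛ I → Adj E u w →
              Broadcast E (I ∪ receivers ((u , w) ∷ [])) t → Broadcast E I (suc t)
single-call u∈I w∉I u~w = step _ ((u∈I , w∉I , u~w) ∷ []) ([] AllPairs.∷ AllPairs.[])

module Doubling {N : ℕ} (E : List (Edge N))
  (doubling-adj : ∀ r (u v : Fin N) → toℕ u < 2 ^ r → toℕ v ≡ toℕ u + 2 ^ r → Adj E u v)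
  where

  InformedBelow : Subset N → ℕ → Set
  InformedBelow I p = ∀ v → toℕ v < p → v ∈ₛ I

  -- j + d as a vertex; the fallback j (when j + d ≥ N) is never used.
  shift : ℕ → Fin N → Fin N
  shift d j with toℕ j + d <? N
  ... | yes j+d<N = fromℕ< j+d<N
  ... | no  _     = j

  toℕ-shift : ∀ d j → toℕ j + d < N → toℕ (shift d j) ≡ toℕ j + d
  toℕ-shift d j j+d<N with toℕ j + d <? N
  ... | yes j+d<N′ = toℕ-fromℕ< j+d<N′
  ... | no  j+d≮N  = ⊥-elim (j+d≮N j+d<N)

  -- Already informed targets are skipped: the originator need not be 0.
  Caller : ℕ → Subset N → Fin N → Set
  Caller r I j = toℕ j < 2 ^ r × toℕ j + 2 ^ r < N × shift (2 ^ r) j ∉ₛ I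

  caller? : ∀ r I j → Dec (Caller r I j)
  caller? r I j = (toℕ j <? 2 ^ r) ×-dec (toℕ j + 2 ^ r <? N) ×-dec ¬? (shift (2 ^ r) j ∈? I)

  callers : ℕ → Subset N → List (Fin N)
  callers r I = filter (caller? r I) (allFin N)

  calls : ℕ → Subset N → List (Edge N)
  calls r I = map (λ j → j , shift (2 ^ r) j) (callers r I)

  ValidCall : Subset N → Edge N → Set
  ValidCall I c = proj₁ c ∈ₛ I × proj₂ c ∉ₛ I × Adj E (proj₁ c) (proj₂ c)

  calls-valid : ∀ r I → InformedBelow I (2 ^ r) → All (ValidCall I) (calls r I)
  calls-valid r I below = AllP.map⁺ (All.tabulate λ j∈ → valid (proj₂ (∈-filter⁻ (caller? r I) {xs = allFin N} j∈)))
    where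
    valid : ∀ {j} → Caller r I j → ValidCall I (j , shift (2 ^ r) j)
    valid {j} (j<2^r , j+2^r<N , target∉I) =
      below j j<2^r , target∉I , doubling-adj r j _ j<2^r (toℕ-shift (2 ^ r) j j+2^r<N)

  calls-unique : ∀ r I → Unique (map proj₁ (calls r I))
  calls-unique r I = subst Unique (sym (trans (sym (map-∘ _)) (map-id _))) (filter⁺ (caller? r I) (allFin⁺ N))

  calls-cover : ∀ r I → InformedBelow I (2 ^ r) → InformedBelow (I ∪ receivers (calls r I)) (2 ^ suc r)
  calls-cover r I below v v<2^[1+r] with v ∈? I
  ... | yes v∈I = x∈p∪q⁺ (inj₁ v∈I)
  ... | no  v∉I = x∈p∪q⁺ (inj₂ (subst (_∈ₛ receivers (calls r I)) shift-j≡v (∈-receivers j-call∈)))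
    where
    instance _ = m^n≢0 2 r
    j : Fin N
    j = fromℕ< (≤-<-trans (m∸n≤m (toℕ v) (2 ^ r)) (toℕ<n v))
    toℕ-j : toℕ j ≡ toℕ v ∸ 2 ^ r
    toℕ-j = toℕ-fromℕ< _
    j+2^r≡v : toℕ j + 2 ^ r ≡ toℕ v
    j+2^r≡v = trans (cong (_+ 2 ^ r) toℕ-j) (m∸n+n≡m (≮⇒≥ (v∉I ∘ below v)))
    j<2^r : toℕ j < 2 ^ r
    j<2^r = subst (_< 2 ^ r) (sym toℕ-j)
      (m<n+o⇒m∸n<o (toℕ v) (2 ^ r) (subst (toℕ v <_) (2^[1+n]≡2^n+2^n r) v<2^[1+r]))
    j+2^r<N : toℕ j + 2 ^ r < N
    j+2^r<N = subst (_< N) (sym j+2^r≡v) (toℕ<n v)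
    shift-j≡v : shift (2 ^ r) j ≡ v
    shift-j≡v = toℕ-injective (trans (toℕ-shift (2 ^ r) j j+2^r<N) j+2^r≡v)
    j-call∈ : (j , shift (2 ^ r) j) ∈ₗ calls r I
    j-call∈ = ∈-map⁺ _ (∈-filter⁺ (caller? r I) (∈-allFin j)
      (j<2^r , j+2^r<N , subst (_∉ₛ I) (sym shift-j≡v) v∉I))

  broadcast : ∀ t r I → InformedBelow I (2 ^ r) → N ≤ 2 ^ (r + t) → Broadcast E I t
  broadcast zero    r I below N≤2^r =
    done λ v → below v (<-≤-trans (toℕ<n v) (subst (λ e → N ≤ 2 ^ e) (+-identityʳ r) N≤2^r))
  broadcast (suc t) r I below N≤2^[r+1+t] =
    step (calls r I) (calls-valid r I below) (calls-unique r I)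
      (broadcast t (suc r) _ (calls-cover r I below) (subst (λ e → N ≤ 2 ^ e) (+-suc r t) N≤2^[r+1+t]))

G-broadcast-from-apex : ∀ m t (I : Subset (2 + m)) → zero ∈ₛ I → 2 + m ≤ 2 ^ t → Broadcast (G m) I t
G-broadcast-from-apex m t I 0∈I = broadcast t 0 I λ { zero _ → 0∈I ; (suc _) (s≤s ()) }
  where open Doubling (G m) (G-doubling-adj m)

G-broadcast : ∀ m → BroadcastTime≤ (G m) (⌈log₂ (2 + m) ⌉ + 1)
G-broadcast m v = from (v ≟ zero)
  where
  T = ⌈log₂ (2 + m) ⌉
  N≤2^T : 2 + m ≤ 2 ^ T
  N≤2^T = n≤2^⌈log₂n⌉ (2 + m)
  from : Dec (v ≡ zero) → Broadcast (G m) ⁅ v ⁆ (T + 1)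
  from (yes refl) = G-broadcast-from-apex m (T + 1) _ (x∈⁅x⁆ zero) (≤-trans N≤2^T (^-monoʳ-≤ 2 (m≤m+n T 1)))
  from (no v≢0)   = subst (Broadcast (G m) ⁅ v ⁆) (+-comm 1 T)
    (single-call (x∈⁅x⁆ v) (v≢0 ∘ sym ∘ x∈⁅y⁆⇒x≡y v) (inj₂ (apex∈G m v v≢0))
      (G-broadcast-from-apex m T _ (x∈p∪q⁺ (inj₂ (∈-receivers {cs = (v , zero) ∷ []} (here refl)))) N≤2^T))

theorem4 : (n : ℕ) → 2 ≤ n →
    Σ (List (Edge n)) (λ E → SimpleSP n E × BroadcastTime≤ E (⌈log₂ n ⌉ + 1))
theorem4 (suc zero)    (s≤s ())
theorem4 (suc (suc m)) _ = G m , G-simple m , G-broadcast m
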